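{- Let $X,Y\subseteq\mathbb{N}$, let $n\ge1$ and $s\ge0$ be integers. Then $$P_{n,s}^{X,Y}=|X_n^c|!\sum_{r=0}^{|X_n|-s}(-1)^{|X_n|-s-r}\binom{|X_n^c|+r}{r}\binom{n+1}{|X_n|-s-r}\prod_{x\in X_n}\bigl(r+\beta_{X,n,x}-\beta_{Y,n,x}\bigr).$$
   Context: $\mathbb{N}=\{1,2,\dots\}$, $S_n$ is the set of permutations $\sigma=\sigma_1\cdots\sigma_n$ of $[n]=\{1,\dots,n\}$. For $X,Y\subseteq\mathbb{N}$, an $X,Y$-descent of $\sigma$ is an index $i$ with $\sigma_i>\sigma_{i+1}$, $\sigma_i\in X$, $\sigma_{i+1}\in Y$; $des_{X,Y}(\sigma)$ is the number of such $i$, and $P_{n,s}^{X,Y}$ is the number of $\sigma\in S_n$ with $des_{X,Y}(\sigma)=s$. For $S\subseteq\mathbb{N}$: $S_n=S\cap[n]$, $S_n^c=[n]\setminus S$, and for $1\le j\le n$, $\beta_{S,n,j}=|\{z:1\le z<j,\ z\notin S\}|$. An empty sum is $0$. -}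

module Defs where

open import Data.Bool using (Bool; true; false; _∧_; not; if_then_else_)
open import Data.Nat using (ℕ; zero; suc; _+_; _∸_; _<ᵇ_)
open import Data.Nat.Properties using (_≟_)
open import Data.Integer as ℤ using (ℤ; +_; -[1+_])
open import Data.List using (List; []; _∷_; length; filter; filterᵇ; map; concatMap; upTo)
import Data.List.Relation.Unary.Unique.DecPropositional as UniqueDec
open import Relation.Nullary.Decidable using (does)

Subset : Set
Subset = ℕ → Bool

oneTo : ℕ → List ℕ
oneTo n = map suc (upTo n)

words : ℕ → List ℕ → List (List ℕ)
words zero    A = [] ∷ []
words (suc k) A = concatMap (λ a → map (a ∷_) (words k A)) A

Sym : ℕ → List (List ℕ)
Sym n = filter (UniqueDec.unique? _≟_) (words n (oneTo n))

des : Subset → Subset → List ℕ → ℕ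
des X Y (a ∷ b ∷ rest) =
  (if (b <ᵇ a) ∧ X a ∧ Y b then 1 else 0) + des X Y (b ∷ rest)
des X Y _ = 0

P : Subset → Subset → ℕ → ℕ → ℕ
P X Y n s = length (filter (λ σ → des X Y σ ≟ s) (Sym n))

restrict : Subset → ℕ → List ℕ
restrict S n = filterᵇ S (oneTo n)

restrictᶜ : Subset → ℕ → List ℕ
restrictᶜ S n = filterᵇ (λ z → not (S z)) (oneTo n)

-- β_{S,n,j} = |{ z : 1 ≤ z < j, z ∉ S }|   (for 1 ≤ j ≤ n; independent of n)
β : Subset → ℕ → ℕ → ℕ
β S n j = length (filterᵇ (λ z → not (S z)) (oneTo (j ∸ 1)))

-- Σ_{r=0}^{m} f r for an integer upper bound m; empty (= 0) when m < 0
sumTo : ℤ → (ℕ → ℤ) → ℤ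
sumTo (+ m)    f = go (suc m)
  where
  go : ℕ → ℤ
  go zero    = + 0
  go (suc k) = go k ℤ.+ f k
sumTo -[1+ _ ] f = + 0

prodℤ : List ℤ → ℤ
prodℤ []       = + 1
prodℤ (x ∷ xs) = x ℤ.* prodℤ xs

-- Write c = |X_n^c|, m = |X_n| and d(σ) = des_{X,Y}(σ). The heart of the proof is the identity, for every r,
--   Σ_{σ ∈ S_n} C(c + r + d(σ), n) = c! C(c + r, r) ∏_{x ∈ X_n} (r + β_{X,n,x} − β_{Y,n,x}),
-- proved by induction on n: every σ ∈ S_{n+1} arises from exactly one τ ∈ S_n by inserting n+1. If n+1 ∈ X,
-- each of the n+1 insertions keeps d(τ) or raises it by one, the latter in exactly |τ ∩ Y| − d(τ) slots; if
-- n+1 ∉ X, exactly d(τ) insertions lower it by one and the others keep it. Pascal's rule and absorption then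
-- turn the inner sums into the new factor r + β_{X,n,n+1} − β_{Y,n,n+1}, resp. c + r + 1.
-- Applying Σ_{r ≤ M} (−1)^{M−r} C(n+1, M−r) (·) with M = m − s collapses the left side to P_{n,s}, because for
-- e ≤ n that combination of C(e + r, n) is the (n+1)-st backward difference of t ↦ C(t, n) at e + M, namely
-- [e + M = n].

module Submission where

open import Defs
open import Data.Bool using (Bool; true; false; not; _∧_; if_then_else_; T)
open import Data.Bool.Properties using (T-≡)
open import Data.Nat using (ℕ; zero; suc; _+_; _*_; _∸_; _≤_; _<_; z≤n; s≤s; _<ᵇ_; _!)
import Data.Nat.Properties as ℕ
import Data.Nat.Tactic.RingSolver as ℕ-Solver
open import Data.Nat.Combinatorics using (_C_; nCk+nC[k+1]≡[n+1]C[k+1]; nCk≡nC[n∸k]; nCn≡1)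
open import Data.Nat.Combinatorics.Specification using (k>n⇒nCk≡0)
open import Data.Integer as ℤ using (ℤ; +_; -_; _^_; -[1+_])
import Data.Integer.Properties as ℤ
open import Data.Integer.Tactic.RingSolver using (solve-∀)
open import Data.List using (List; []; _∷_; _++_; [_]; length; map; concatMap; filter; filterᵇ; upTo)
open import Data.List.Properties as List using (∷-injectiveˡ; ∷-injectiveʳ; length-map; length-upTo; map-++)
open import Data.List.Membership.Propositional using (_∈_; _∉_; find; lose)
open import Data.List.Membership.Propositional.Properties
  using (∈-∃++; ∈-++⁺ˡ; ∈-++⁺ʳ; ∈-++⁻; ∈-concatMap⁺; ∈-concatMap⁻; ∈-map⁺; ∈-map⁻;
         ∈-filter⁺; ∈-filter⁻)
open import Data.List.Membership.DecPropositional ℕ._≟_ using (_∈?_)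
open import Data.List.Relation.Unary.Any using (here; there)
open import Data.List.Relation.Unary.All as All using (All; []; _∷_)
open import Data.List.Relation.Unary.AllPairs as AllPairs using ([]; _∷_)
open import Data.List.Relation.Unary.Unique.Propositional using (Unique)
import Data.List.Relation.Unary.Unique.Propositional.Properties as Unique
import Data.List.Relation.Unary.Unique.DecPropositional as UniqueDec
open import Data.List.Relation.Binary.Subset.Propositional using (_⊆_)
open import Data.List.Relation.Binary.Permutation.Propositional as ↭
  using (_↭_; ↭-refl; ↭-sym; ↭-trans; ↭-prep; ↭⇒↭ₛ)
open import Data.List.Relation.Binary.Permutation.Propositional.Properties
  using (shift; ∷↭∷ʳ; ↭-length; ∈-resp-↭; All-resp-↭; filter-↭)
import Data.List.Relation.Binary.Permutation.Setoid.Properties as ↭ₛ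
open import Data.Product using (_×_; _,_; proj₁; ∃; ∃₂)
open import Data.Sum using (_⊎_; inj₁; inj₂)
open import Function using (_∘_)
open import Function.Bundles using (Equivalence)
open import Relation.Nullary using (¬_; contradiction)
open import Relation.Nullary.Decidable using (T?; yes; no)
open import Relation.Binary.PropositionalEquality hiding ([_])
open ≡-Reasoning

-- Binomial coefficients

binom : ℕ → ℕ → ℕ
binom zero    zero    = 1
binom zero    (suc k) = 0
binom (suc n) zero    = 1
binom (suc n) (suc k) = binom n k + binom n (suc k)

C≡binom : ∀ n k → n C k ≡ binom n k
C≡binom zero    zero    = refl
C≡binom zero    (suc k) = k>n⇒nCk≡0 {0} {suc k} (s≤s z≤n)
C≡binom (suc n) zero    = trans (nCk≡nC[n∸k] {0} {suc n} z≤n) (nCn≡1 (suc n))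
C≡binom (suc n) (suc k) =
  trans (sym (nCk+nC[k+1]≡[n+1]C[k+1] n k)) (cong₂ _+_ (C≡binom n k) (C≡binom n (suc k)))

binom-n0 : ∀ n → binom n 0 ≡ 1
binom-n0 zero    = refl
binom-n0 (suc n) = refl

binom-n1 : ∀ n → binom n 1 ≡ n
binom-n1 zero    = refl
binom-n1 (suc n) = cong₂ _+_ (binom-n0 n) (binom-n1 n)

binom-nn : ∀ n → binom n n ≡ 1
binom-nn n = trans (sym (C≡binom n n)) (nCn≡1 n)

binom-< : ∀ {n k} → n < k → binom n k ≡ 0
binom-< {zero}  {suc k} _         = refl
binom-< {suc n} {suc k} (s≤s n<k) = cong₂ _+_ (binom-< n<k) (binom-< (ℕ.m<n⇒m<1+n n<k))

binom-absorb : ∀ n k → suc k * binom (suc n) (suc k) ≡ suc n * binom n k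
binom-absorb n       zero    = begin
  1 * binom (suc n) 1 ≡⟨ ℕ.*-identityˡ _ ⟩
  binom (suc n) 1     ≡⟨ binom-n1 (suc n) ⟩
  suc n               ≡⟨ ℕ.*-identityʳ (suc n) ⟨
  suc n * 1           ≡⟨ cong (suc n *_) (binom-n0 n) ⟨
  suc n * binom n 0   ∎
binom-absorb zero    (suc k) = ℕ.*-zeroʳ (suc (suc k))
binom-absorb (suc n) (suc k) = begin
  suc (suc k) * (b₁ + b₂)                                ≡⟨ regroup (suc k) b₁ b₂ ⟩
  b₁ + (suc k * b₁ + suc (suc k) * b₂)                   ≡⟨ cong (_+_ b₁) (cong₂ _+_ (binom-absorb n k)
                                                                                     (binom-absorb n (suc k))) ⟩
  b₁ + (suc n * binom n k + suc n * binom n (suc k))     ≡⟨ cong (_+_ b₁) (ℕ.*-distribˡ-+ (suc n) (binom n k) _) ⟨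
  suc (suc n) * b₁                                       ∎
  where
  b₁ = binom (suc n) (suc k)
  b₂ = binom (suc n) (suc (suc k))
  regroup : ∀ k x y → suc k * (x + y) ≡ x + (k * x + suc k * y)
  regroup = ℕ-Solver.solve-∀

binom-sym : ∀ a b → binom (a + b) a ≡ binom (a + b) b
binom-sym a b = begin
  binom (a + b) a     ≡⟨ C≡binom (a + b) a ⟨
  (a + b) C a         ≡⟨ nCk≡nC[n∸k] (ℕ.m≤m+n a b) ⟩
  (a + b) C (a + b ∸ a) ≡⟨ cong ((a + b) C_) (ℕ.m+n∸m≡n a b) ⟩
  (a + b) C b         ≡⟨ C≡binom (a + b) b ⟩
  binom (a + b) b     ∎

binom-absorb-complement : ∀ c r → suc c * binom (suc c + r) r ≡ (suc c + r) * binom (c + r) r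
binom-absorb-complement c r = begin
  suc c * binom (suc c + r) r         ≡⟨ cong (suc c *_) (binom-sym (suc c) r) ⟨
  suc c * binom (suc (c + r)) (suc c) ≡⟨ binom-absorb (c + r) c ⟩
  suc (c + r) * binom (c + r) c       ≡⟨ cong (suc (c + r) *_) (binom-sym c r) ⟩
  (suc c + r) * binom (c + r) r       ∎

pascal-Δ : ∀ K k → + binom (suc K) (suc k) ℤ.- + binom K (suc k) ≡ + binom K k
pascal-Δ K k = trans (cong (ℤ._- + binom K (suc k)) (ℤ.pos-+ (binom K k) _)) (cancel (+ binom K k) (+ binom K (suc k)))
  where
  cancel : ∀ x y → (x ℤ.+ y) ℤ.- y ≡ x
  cancel = solve-∀

binom-absorbℤ : ∀ K k → + suc k ℤ.* + binom (suc K) (suc k) ≡ + suc K ℤ.* + binom K k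
binom-absorbℤ K k = trans (sym (ℤ.pos-* (suc k) _)) (trans (cong +_ (binom-absorb K k)) (ℤ.pos-* (suc K) _))

binom-ratioℤ : ∀ K k → + suc k ℤ.* + binom K (suc k) ≡ (+ K ℤ.- + k) ℤ.* + binom K k
binom-ratioℤ K k = begin
  + suc k ℤ.* b₁                                ≡⟨ expand (+ k) b₀ b₁ ⟩
  + suc k ℤ.* (b₀ ℤ.+ b₁) ℤ.- + suc k ℤ.* b₀    ≡⟨ cong (λ x → + suc k ℤ.* x ℤ.- + suc k ℤ.* b₀) (ℤ.pos-+ (binom K k) _) ⟨
  + suc k ℤ.* + binom (suc K) (suc k) ℤ.- + suc k ℤ.* b₀ ≡⟨ cong (ℤ._- + suc k ℤ.* b₀) (binom-absorbℤ K k) ⟩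
  + suc K ℤ.* b₀ ℤ.- + suc k ℤ.* b₀             ≡⟨ collect (+ K) (+ k) b₀ ⟩
  (+ K ℤ.- + k) ℤ.* b₀                          ∎
  where
  b₀ = + binom K k
  b₁ = + binom K (suc k)
  expand : ∀ k b₀ b₁ → (+ 1 ℤ.+ k) ℤ.* b₁ ≡ (+ 1 ℤ.+ k) ℤ.* (b₀ ℤ.+ b₁) ℤ.- (+ 1 ℤ.+ k) ℤ.* b₀
  expand = solve-∀
  collect : ∀ K k b → (+ 1 ℤ.+ K) ℤ.* b ℤ.- (+ 1 ℤ.+ k) ℤ.* b ≡ (K ℤ.- k) ℤ.* b
  collect = solve-∀

factorial-binom-suc : ∀ c r → suc c ! * binom (suc c + r) r ≡ suc (c + r) * (c ! * binom (c + r) r)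
factorial-binom-suc c r = begin
  (suc c * c !) * binom (suc c + r) r   ≡⟨ swap (suc c) (c !) (binom (suc c + r) r) ⟩
  c ! * (suc c * binom (suc c + r) r)   ≡⟨ cong (c ! *_) (binom-absorb-complement c r) ⟩
  c ! * (suc (c + r) * binom (c + r) r) ≡⟨ swap′ (c !) (suc (c + r)) (binom (c + r) r) ⟩
  suc (c + r) * (c ! * binom (c + r) r) ∎
  where
  swap : ∀ a b x → (a * b) * x ≡ b * (a * x)
  swap = ℕ-Solver.solve-∀
  swap′ : ∀ a b x → a * (b * x) ≡ b * (a * x)
  swap′ = ℕ-Solver.solve-∀

-- Sums of integers over ranges and lists

Σ< : ℕ → (ℕ → ℤ) → ℤ
Σ< zero    f = + 0
Σ< (suc k) f = Σ< k f ℤ.+ f k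

Σ<-cong : ∀ k {f g : ℕ → ℤ} → (∀ r → r < k → f r ≡ g r) → Σ< k f ≡ Σ< k g
Σ<-cong zero    f≡g = refl
Σ<-cong (suc k) f≡g = cong₂ ℤ._+_ (Σ<-cong k (λ r r<k → f≡g r (ℕ.m<n⇒m<1+n r<k))) (f≡g k ℕ.≤-refl)

Σ<-zero : ∀ k {f : ℕ → ℤ} → (∀ r → r < k → f r ≡ + 0) → Σ< k f ≡ + 0
Σ<-zero zero    f≡0 = refl
Σ<-zero (suc k) f≡0 = cong₂ ℤ._+_ (Σ<-zero k (λ r r<k → f≡0 r (ℕ.m<n⇒m<1+n r<k))) (f≡0 k ℕ.≤-refl)

Σ<-minus : ∀ k (f g : ℕ → ℤ) → Σ< k (λ r → f r ℤ.- g r) ≡ Σ< k f ℤ.- Σ< k g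
Σ<-minus zero    f g = refl
Σ<-minus (suc k) f g = trans (cong (ℤ._+ (f k ℤ.- g k)) (Σ<-minus k f g)) (regroup (Σ< k f) (Σ< k g) (f k) (g k))
  where
  regroup : ∀ a b c d → (a ℤ.- b) ℤ.+ (c ℤ.- d) ≡ (a ℤ.+ c) ℤ.- (b ℤ.+ d)
  regroup = solve-∀

*-distribˡ-Σ< : ∀ k c (f : ℕ → ℤ) → c ℤ.* Σ< k f ≡ Σ< k (λ r → c ℤ.* f r)
*-distribˡ-Σ< zero    c f = ℤ.*-zeroʳ c
*-distribˡ-Σ< (suc k) c f = trans (ℤ.*-distribˡ-+ c (Σ< k f) (f k)) (cong (ℤ._+ c ℤ.* f k) (*-distribˡ-Σ< k c f))

sumTo≡Σ< : ∀ m f → sumTo (+ m) f ≡ Σ< (suc m) f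
sumTo≡Σ< zero    f = refl
sumTo≡Σ< (suc m) f = cong (ℤ._+ f (suc m)) (sumTo≡Σ< m f)

Σ∈ : {A : Set} → List A → (A → ℤ) → ℤ
Σ∈ []       f = + 0
Σ∈ (x ∷ xs) f = f x ℤ.+ Σ∈ xs f

module _ {A : Set} where

  Σ∈-↭ : ∀ {xs ys : List A} (f : A → ℤ) → xs ↭ ys → Σ∈ xs f ≡ Σ∈ ys f
  Σ∈-↭ f ↭.refl          = refl
  Σ∈-↭ f (↭.prep x p)    = cong (ℤ._+_ (f x)) (Σ∈-↭ f p)
  Σ∈-↭ f (↭.swap x y p)  = trans (cong (λ s → f x ℤ.+ (f y ℤ.+ s)) (Σ∈-↭ f p)) (swap-+ (f x) (f y) _)
    where
    swap-+ : ∀ a b c → a ℤ.+ (b ℤ.+ c) ≡ b ℤ.+ (a ℤ.+ c)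
    swap-+ = solve-∀
  Σ∈-↭ f (↭.trans p q)   = trans (Σ∈-↭ f p) (Σ∈-↭ f q)

  Σ∈-++ : ∀ xs {ys : List A} f → Σ∈ (xs ++ ys) f ≡ Σ∈ xs f ℤ.+ Σ∈ ys f
  Σ∈-++ []       f = sym (ℤ.+-identityˡ _)
  Σ∈-++ (x ∷ xs) f = trans (cong (ℤ._+_ (f x)) (Σ∈-++ xs f)) (sym (ℤ.+-assoc (f x) _ _))

  Σ∈-cong : ∀ (xs : List A) {f g} → (∀ x → x ∈ xs → f x ≡ g x) → Σ∈ xs f ≡ Σ∈ xs g
  Σ∈-cong []       f≡g = refl
  Σ∈-cong (x ∷ xs) f≡g = cong₂ ℤ._+_ (f≡g x (here refl)) (Σ∈-cong xs (λ y y∈ → f≡g y (there y∈)))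

  Σ∈-zero : ∀ (xs : List A) {f} → (∀ x → x ∈ xs → f x ≡ + 0) → Σ∈ xs f ≡ + 0
  Σ∈-zero []       f≡0 = refl
  Σ∈-zero (x ∷ xs) f≡0 = cong₂ ℤ._+_ (f≡0 x (here refl)) (Σ∈-zero xs (λ y y∈ → f≡0 y (there y∈)))

  Σ∈-+ : ∀ (xs : List A) f g → Σ∈ xs (λ x → f x ℤ.+ g x) ≡ Σ∈ xs f ℤ.+ Σ∈ xs g
  Σ∈-+ []       f g = refl
  Σ∈-+ (x ∷ xs) f g = trans (cong (ℤ._+_ (f x ℤ.+ g x)) (Σ∈-+ xs f g)) (regroup (f x) (g x) _ _)
    where
    regroup : ∀ a b c d → (a ℤ.+ b) ℤ.+ (c ℤ.+ d) ≡ (a ℤ.+ c) ℤ.+ (b ℤ.+ d)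
    regroup = solve-∀

  *-distribˡ-Σ∈ : ∀ (xs : List A) c f → c ℤ.* Σ∈ xs f ≡ Σ∈ xs (λ x → c ℤ.* f x)
  *-distribˡ-Σ∈ []       c f = ℤ.*-zeroʳ c
  *-distribˡ-Σ∈ (x ∷ xs) c f =
    trans (ℤ.*-distribˡ-+ c (f x) _) (cong (ℤ._+_ (c ℤ.* f x)) (*-distribˡ-Σ∈ xs c f))

  Σ<-Σ∈-comm : ∀ k (xs : List A) (h : A → ℕ → ℤ) →
    Σ< k (λ r → Σ∈ xs (λ x → h x r)) ≡ Σ∈ xs (λ x → Σ< k (h x))
  Σ<-Σ∈-comm zero    xs h = sym (Σ∈-zero xs (λ _ _ → refl))
  Σ<-Σ∈-comm (suc k) xs h =
    trans (cong (ℤ._+ Σ∈ xs (λ x → h x k)) (Σ<-Σ∈-comm k xs h))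
          (sym (Σ∈-+ xs (λ x → Σ< k (h x)) (λ x → h x k)))

module _ {A B : Set} where

  Σ∈-map : ∀ (f : A → B) xs (g : B → ℤ) → Σ∈ (map f xs) g ≡ Σ∈ xs (g ∘ f)
  Σ∈-map f []       g = refl
  Σ∈-map f (x ∷ xs) g = cong (ℤ._+_ (g (f x))) (Σ∈-map f xs g)

  Σ∈-concatMap : ∀ (f : A → List B) xs g → Σ∈ (concatMap f xs) g ≡ Σ∈ xs (λ x → Σ∈ (f x) g)
  Σ∈-concatMap f []       g = refl
  Σ∈-concatMap f (x ∷ xs) g = trans (Σ∈-++ (f x) g) (cong (ℤ._+_ (Σ∈ (f x) g)) (Σ∈-concatMap f xs g))

δ : ℕ → ℕ → ℤ
δ zero    zero    = + 1
δ zero    (suc _) = + 0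
δ (suc _) zero    = + 0
δ (suc a) (suc b) = δ a b

δ-refl : ∀ a → δ a a ≡ + 1
δ-refl zero    = refl
δ-refl (suc a) = δ-refl a

δ-≢ : ∀ {a b} → a ≢ b → δ a b ≡ + 0
δ-≢ {zero}  {zero}  a≢b = contradiction refl a≢b
δ-≢ {zero}  {suc b} _   = refl
δ-≢ {suc a} {zero}  _   = refl
δ-≢ {suc a} {suc b} a≢b = δ-≢ (a≢b ∘ cong suc)

δ-+ˡ : ∀ k a b → δ (k + a) (k + b) ≡ δ a b
δ-+ˡ zero    a b = refl
δ-+ˡ (suc k) a b = δ-+ˡ k a b

length-filter≡Σ∈δ : ∀ {A : Set} (f : A → ℕ) s xs →
  + length (filter (λ x → f x ℕ.≟ s) xs) ≡ Σ∈ xs (λ x → δ (f x) s)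
length-filter≡Σ∈δ f s []       = refl
length-filter≡Σ∈δ f s (x ∷ xs) with f x ℕ.≟ s
... | yes fx≡s = begin
  + length (filter P? (x ∷ xs))          ≡⟨ cong (+_ ∘ length) (List.filter-accept P? fx≡s) ⟩
  + 1 ℤ.+ + length (filter P? xs)        ≡⟨ cong₂ ℤ._+_ (sym δ≡1) (length-filter≡Σ∈δ f s xs) ⟩
  δ (f x) s ℤ.+ Σ∈ xs (λ x → δ (f x) s) ∎
  where
  P? = λ x → f x ℕ.≟ s
  δ≡1 : δ (f x) s ≡ + 1
  δ≡1 = trans (cong (λ a → δ a s) fx≡s) (δ-refl s)
... | no fx≢s = begin
  + length (filter P? (x ∷ xs))          ≡⟨ cong (+_ ∘ length) (List.filter-reject P? fx≢s) ⟩
  + length (filter P? xs)                ≡⟨ length-filter≡Σ∈δ f s xs ⟩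
  Σ∈ xs (λ x → δ (f x) s)                ≡⟨ ℤ.+-identityˡ _ ⟨
  + 0 ℤ.+ Σ∈ xs (λ x → δ (f x) s)        ≡⟨ cong (ℤ._+ Σ∈ xs (λ x → δ (f x) s)) (δ-≢ fx≢s) ⟨
  δ (f x) s ℤ.+ Σ∈ xs (λ x → δ (f x) s) ∎
  where P? = λ x → f x ℕ.≟ s

-- Backward differences (with v (-1) = 0)

∇ : (ℕ → ℤ) → ℕ → ℤ
∇ v zero    = v zero
∇ v (suc t) = v (suc t) ℤ.- v t

∇^ : ℕ → (ℕ → ℤ) → ℕ → ℤ
∇^ zero    v = v
∇^ (suc a) v = ∇^ a (∇ v)

∇-cong : ∀ {v w : ℕ → ℤ} → (∀ t → v t ≡ w t) → ∀ t → ∇ v t ≡ ∇ w t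
∇-cong v≡w zero    = v≡w 0
∇-cong v≡w (suc t) = cong₂ ℤ._-_ (v≡w (suc t)) (v≡w t)

∇^-cong : ∀ a {v w : ℕ → ℤ} → (∀ t → v t ≡ w t) → ∀ t → ∇^ a v t ≡ ∇^ a w t
∇^-cong zero    v≡w = v≡w
∇^-cong (suc a) v≡w = ∇^-cong a (∇-cong v≡w)

∇^-suc : ∀ a v t → ∇^ (suc a) v t ≡ ∇ (∇^ a v) t
∇^-suc zero    v t = refl
∇^-suc (suc a) v t = ∇^-suc a (∇ v) t

∇^-vanishing : ∀ a v e → (∀ t → t < e → v t ≡ + 0) → ∀ t → t < e → ∇^ a v t ≡ + 0
∇^-vanishing zero    v e v≡0 = v≡0
∇^-vanishing (suc a) v e v≡0 = ∇^-vanishing a (∇ v) e ∇v≡0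
  where
  ∇v≡0 : ∀ t → t < e → ∇ v t ≡ + 0
  ∇v≡0 zero    t<e = v≡0 0 t<e
  ∇v≡0 (suc t) t<e = cong₂ ℤ._-_ (v≡0 (suc t) t<e) (v≡0 t (ℕ.<-trans (ℕ.n<1+n t) t<e))

sgn : ℕ → ℤ
sgn k = (- + 1) ^ k

module _ (v : ℕ → ℤ) (e : ℕ) (v≡0 : ∀ t → t < e → v t ≡ + 0) where

  private
    altTerm : ℕ → ℕ → ℕ → ℤ
    altTerm a M r = sgn (M ∸ r) ℤ.* + binom a (M ∸ r) ℤ.* v (e + r)

    altTerm-top : ∀ a M → altTerm a M M ≡ v (e + M)
    altTerm-top a M = begin
      sgn (M ∸ M) ℤ.* + binom a (M ∸ M) ℤ.* v (e + M)
        ≡⟨ cong (λ k → sgn k ℤ.* + binom a k ℤ.* v (e + M)) (ℕ.n∸n≡0 M) ⟩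
      + 1 ℤ.* + binom a 0 ℤ.* v (e + M)
        ≡⟨ cong (λ b → + 1 ℤ.* + b ℤ.* v (e + M)) (binom-n0 a) ⟩
      + 1 ℤ.* v (e + M)
        ≡⟨ ℤ.*-identityˡ _ ⟩
      v (e + M) ∎

  ∇^-below : ∀ a t → t ≤ e → ∇^ a v t ≡ v t
  ∇^-below zero    t t≤e = refl
  ∇^-below (suc a) t t≤e = trans (∇^-suc a v t) (trans (∇-prev-vanishing t t≤e) (∇^-below a t t≤e))
    where
    ∇-prev-vanishing : ∀ t → t ≤ e → ∇ (∇^ a v) t ≡ ∇^ a v t
    ∇-prev-vanishing zero    _     = refl
    ∇-prev-vanishing (suc t) t<e =
      trans (cong (ℤ._-_ (∇^ a v (suc t))) (∇^-vanishing a v e v≡0 t t<e)) (ℤ.+-identityʳ _)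

  ∇^-alternating-sum : ∀ a M →
    Σ< (suc M) (λ r → sgn (M ∸ r) ℤ.* + binom a (M ∸ r) ℤ.* v (e + r)) ≡ ∇^ a v (e + M)
  ∇^-alternating-sum zero    M = begin
    Σ< M (altTerm 0 M) ℤ.+ altTerm 0 M M ≡⟨ cong₂ ℤ._+_ (Σ<-zero M below-top) (altTerm-top 0 M) ⟩
    + 0 ℤ.+ v (e + M)        ≡⟨ ℤ.+-identityˡ _ ⟩
    v (e + M)                ∎
    where
    below-top : ∀ r → r < M → altTerm 0 M r ≡ + 0
    below-top r r<M = begin
      sgn (M ∸ r) ℤ.* + binom 0 (M ∸ r) ℤ.* v (e + r)
        ≡⟨ cong (λ b → sgn (M ∸ r) ℤ.* + b ℤ.* v (e + r)) (binom-< (ℕ.m<n⇒0<n∸m r<M)) ⟩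
      sgn (M ∸ r) ℤ.* + 0 ℤ.* v (e + r)
        ≡⟨ cong (ℤ._* v (e + r)) (ℤ.*-zeroʳ (sgn (M ∸ r))) ⟩
      + 0 ℤ.* v (e + r)
        ≡⟨ ℤ.*-zeroˡ (v (e + r)) ⟩
      + 0 ∎
  ∇^-alternating-sum (suc a) zero = begin
    + 0 ℤ.+ altTerm (suc a) 0 0 ≡⟨ ℤ.+-identityˡ _ ⟩
    altTerm (suc a) 0 0         ≡⟨ altTerm-top (suc a) 0 ⟩
    v (e + 0)             ≡⟨ ∇^-below (suc a) (e + 0) (ℕ.≤-reflexive (ℕ.+-identityʳ e)) ⟨
    ∇^ (suc a) v (e + 0)  ∎
  ∇^-alternating-sum (suc a) (suc M) = begin
    Σ< (suc M) F ℤ.+ F (suc M)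
      ≡⟨ cong₂ ℤ._+_ (Σ<-cong (suc M) pascal-split)
                     (trans (altTerm-top (suc a) (suc M)) (sym (altTerm-top a (suc M)))) ⟩
    Σ< (suc M) (λ r → G r ℤ.- H r) ℤ.+ G (suc M)
      ≡⟨ cong (ℤ._+ G (suc M)) (Σ<-minus (suc M) G H) ⟩
    (Σ< (suc M) G ℤ.- Σ< (suc M) H) ℤ.+ G (suc M)
      ≡⟨ regroup (Σ< (suc M) G) (Σ< (suc M) H) (G (suc M)) ⟩
    Σ< (suc (suc M)) G ℤ.- Σ< (suc M) H
      ≡⟨ cong₂ ℤ._-_ (∇^-alternating-sum a (suc M)) (∇^-alternating-sum a M) ⟩
    ∇^ a v (e + suc M) ℤ.- ∇^ a v (e + M)
      ≡⟨ cong (λ t → ∇^ a v t ℤ.- ∇^ a v (e + M)) (ℕ.+-suc e M) ⟩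
    ∇ (∇^ a v) (suc (e + M))
      ≡⟨ ∇^-suc a v (suc (e + M)) ⟨
    ∇^ (suc a) v (suc (e + M))
      ≡⟨ cong (∇^ (suc a) v) (ℕ.+-suc e M) ⟨
    ∇^ (suc a) v (e + suc M) ∎
    where
    F = altTerm (suc a) (suc M)
    G = altTerm a (suc M)
    H = altTerm a M
    regroup : ∀ x y z → (x ℤ.- y) ℤ.+ z ≡ (x ℤ.+ z) ℤ.- y
    regroup = solve-∀
    split : ∀ s b c w →
      (- + 1 ℤ.* s) ℤ.* (b ℤ.+ c) ℤ.* w ≡ (- + 1 ℤ.* s) ℤ.* c ℤ.* w ℤ.- s ℤ.* b ℤ.* w
    split = solve-∀
    pascal-split : ∀ r → r < suc M → F r ≡ G r ℤ.- H r
    pascal-split r (s≤s r≤M) rewrite ℕ.+-∸-assoc 1 r≤M =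
      trans (cong (λ b → sgn (suc (M ∸ r)) ℤ.* b ℤ.* v (e + r)) (ℤ.pos-+ (binom a (M ∸ r)) _))
            (split (sgn (M ∸ r)) (+ binom a (M ∸ r)) (+ binom a (suc (M ∸ r))) (v (e + r)))

delay : (ℕ → ℤ) → ℕ → ℤ
delay w zero    = + 0
delay w (suc t) = w t

∇^-delay : ∀ a w t → ∇^ a (delay w) t ≡ delay (∇^ a w) t
∇^-delay zero    w t = refl
∇^-delay (suc a) w t = trans (∇^-cong a ∇-delay t) (∇^-delay a (∇ w) t)
  where
  ∇-delay : ∀ t → ∇ (delay w) t ≡ delay (∇ w) t
  ∇-delay zero          = refl
  ∇-delay (suc zero)    = ℤ.+-identityʳ (w 0)
  ∇-delay (suc (suc t)) = refl

∇^-binom : ∀ n t → ∇^ (suc n) (λ t → + binom t n) t ≡ δ t n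
∇^-binom zero    zero    = refl
∇^-binom zero    (suc t) = cong₂ (λ x y → + x ℤ.- + y) (binom-n0 (suc t)) (binom-n0 t)
∇^-binom (suc n) t       = begin
  ∇^ (suc n) (∇ (λ t → + binom t (suc n))) t ≡⟨ ∇^-cong (suc n) ∇-binom-suc t ⟩
  ∇^ (suc n) (delay (λ t → + binom t n)) t   ≡⟨ ∇^-delay (suc n) _ t ⟩
  delay (∇^ (suc n) (λ t → + binom t n)) t   ≡⟨ delay-δ t ⟩
  δ t (suc n)                                ∎
  where
  ∇-binom-suc : ∀ t → ∇ (λ t → + binom t (suc n)) t ≡ delay (λ t → + binom t n) t
  ∇-binom-suc zero    = refl
  ∇-binom-suc (suc t) = pascal-Δ t n
  delay-δ : ∀ t → delay (∇^ (suc n) (λ t → + binom t n)) t ≡ δ t (suc n)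
  delay-δ zero    = refl
  delay-δ (suc t) = ∇^-binom n t

binom-inversion : ∀ n e M → e ≤ n →
  Σ< (suc M) (λ r → sgn (M ∸ r) ℤ.* + binom (suc n) (M ∸ r) ℤ.* + binom (e + r) n) ≡ δ (e + M) n
binom-inversion n e M e≤n =
  trans (∇^-alternating-sum (λ t → + binom t n) e vanish (suc n) M) (∇^-binom n (e + M))
  where
  vanish : ∀ t → t < e → + binom t n ≡ + 0
  vanish t t<e = cong +_ (binom-< (ℕ.<-≤-trans t<e e≤n))

module _ {A : Set} where

  unique-resp-↭ : ∀ {xs ys : List A} → xs ↭ ys → Unique xs → Unique ys
  unique-resp-↭ p = ↭ₛ.Unique-resp-↭ (setoid A) (↭⇒↭ₛ p)

  ∈⇒↭∷ : ∀ {x : A} {ys} → x ∈ ys → ∃ λ rest → ys ↭ x ∷ rest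
  ∈⇒↭∷ {x} x∈ys with ∈-∃++ x∈ys
  ... | ys₁ , ys₂ , refl = ys₁ ++ ys₂ , shift x ys₁ ys₂

  ⊆-drop : ∀ {x : A} {xs rest} → x ∉ xs → xs ⊆ x ∷ rest → xs ⊆ rest
  ⊆-drop x∉xs xs⊆ z∈ with xs⊆ z∈
  ... | here refl = contradiction z∈ x∉xs
  ... | there z∈rest = z∈rest

  unique-⊆⇒length-≤ : ∀ {xs ys : List A} → Unique xs → xs ⊆ ys → length xs ≤ length ys
  unique-⊆⇒length-≤ {[]}     _            _     = z≤n
  unique-⊆⇒length-≤ {x ∷ xs} u@(_ ∷ uxs) xs⊆ys with ∈⇒↭∷ (xs⊆ys (here refl))
  ... | rest , ys↭ = ℕ.≤-trans (s≤s (unique-⊆⇒length-≤ uxs xs⊆rest)) (ℕ.≤-reflexive (sym (↭-length ys↭)))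
    where
    xs⊆rest : xs ⊆ rest
    xs⊆rest = ⊆-drop (Unique.Unique[x∷xs]⇒x∉xs u) (∈-resp-↭ ys↭ ∘ xs⊆ys ∘ there)

  unique-⊆⊇⇒↭ : ∀ {xs ys : List A} → Unique xs → Unique ys → xs ⊆ ys → ys ⊆ xs → xs ↭ ys
  unique-⊆⊇⇒↭ {[]}     _             _   _     ys⊆[] = ⊆[]⇒[]↭ ys⊆[]
    where
    ⊆[]⇒[]↭ : ∀ {ys} → ys ⊆ [] → [] ↭ ys
    ⊆[]⇒[]↭ {[]}    _    = ↭-refl
    ⊆[]⇒[]↭ {y ∷ _} ys⊆ with ys⊆ (here refl)
    ... | ()
  unique-⊆⊇⇒↭ {x ∷ xs} ux@(_ ∷ uxs) uys xs⊆ys ys⊆xs with ∈⇒↭∷ (xs⊆ys (here refl))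
  ... | rest , ys↭ = ↭-trans (↭-prep x xs↭rest) (↭-sym ys↭)
    where
    urest : Unique (x ∷ rest)
    urest = unique-resp-↭ ys↭ uys
    xs↭rest : xs ↭ rest
    xs↭rest = unique-⊆⊇⇒↭ uxs (AllPairs.tail urest)
      (⊆-drop (Unique.Unique[x∷xs]⇒x∉xs ux) (∈-resp-↭ ys↭ ∘ xs⊆ys ∘ there))
      (⊆-drop (Unique.Unique[x∷xs]⇒x∉xs urest) (ys⊆xs ∘ ∈-resp-↭ (↭-sym ys↭) ∘ there))

  unique-concatMap : ∀ {B : Set} (f : A → List B) {xs} → Unique xs →
    (∀ {a} → a ∈ xs → Unique (f a)) →
    (∀ {a b z} → a ∈ xs → b ∈ xs → z ∈ f a → z ∈ f b → a ≡ b) →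
    Unique (concatMap f xs)
  unique-concatMap f {[]}     _           _       _        = []
  unique-concatMap f {x ∷ xs} (x∉ ∷ uxs) unique-f disjoint =
    Unique.++⁺ (unique-f (here refl))
      (unique-concatMap f uxs (unique-f ∘ there) (λ a∈ b∈ → disjoint (there a∈) (there b∈)))
      λ (z∈fx , z∈rest) → let (b , b∈xs , z∈fb) = find (∈-concatMap⁻ f {xs = xs} z∈rest) in
        contradiction (subst (_∈ xs) (sym (disjoint (here refl) (there b∈xs) z∈fx z∈fb)) b∈xs)
                      (Unique.Unique[x∷xs]⇒x∉xs (x∉ ∷ uxs))

-- Permutations of [n]

oneTo-suc : ∀ n → oneTo (suc n) ≡ oneTo n ++ [ suc n ]
oneTo-suc n = trans (cong (map suc) (sym (List.upTo-∷ʳ n))) (map-++ suc (upTo n) [ n ])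

∈oneTo-suc⁻ : ∀ {n x} → x ∈ oneTo (suc n) → x ∈ oneTo n ⊎ x ≡ suc n
∈oneTo-suc⁻ {n} x∈ with ∈-++⁻ (oneTo n) (subst (_ ∈_) (oneTo-suc n) x∈)
... | inj₁ x∈oneTo = inj₁ x∈oneTo
... | inj₂ (here x≡) = inj₂ x≡

∈oneTo-suc⁺ : ∀ {n x} → x ∈ oneTo n → x ∈ oneTo (suc n)
∈oneTo-suc⁺ {n} x∈ = subst (_ ∈_) (sym (oneTo-suc n)) (∈-++⁺ˡ x∈)

suc∈oneTo-suc : ∀ n → suc n ∈ oneTo (suc n)
suc∈oneTo-suc n = subst (suc n ∈_) (sym (oneTo-suc n)) (∈-++⁺ʳ (oneTo n) (here refl))

∈oneTo⇒≤ : ∀ {n x} → x ∈ oneTo n → x ≤ n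
∈oneTo⇒≤ {suc n} x∈ with ∈oneTo-suc⁻ x∈
... | inj₁ x∈oneTo = ℕ.m≤n⇒m≤1+n (∈oneTo⇒≤ x∈oneTo)
... | inj₂ refl    = ℕ.≤-refl

length-oneTo : ∀ n → length (oneTo n) ≡ n
length-oneTo n = trans (length-map suc (upTo n)) (length-upTo n)

oneTo-unique : ∀ n → Unique (oneTo n)
oneTo-unique n = Unique.map⁺ ℕ.suc-injective (Unique.upTo⁺ n)

filterᵇ-oneTo-suc : ∀ (p : ℕ → Bool) n →
  filterᵇ p (oneTo (suc n)) ≡ filterᵇ p (oneTo n) ++ filterᵇ p [ suc n ]
filterᵇ-oneTo-suc p n =
  trans (cong (filterᵇ p) (oneTo-suc n)) (List.filter-++ (T? ∘ p) (oneTo n) [ suc n ])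

filterᵇ-oneTo-suc-accept : ∀ (p : ℕ → Bool) n → p (suc n) ≡ true →
  filterᵇ p (oneTo (suc n)) ≡ filterᵇ p (oneTo n) ++ [ suc n ]
filterᵇ-oneTo-suc-accept p n p[n+1] rewrite filterᵇ-oneTo-suc p n | p[n+1] = refl

filterᵇ-oneTo-suc-reject : ∀ (p : ℕ → Bool) n → p (suc n) ≡ false →
  filterᵇ p (oneTo (suc n)) ≡ filterᵇ p (oneTo n)
filterᵇ-oneTo-suc-reject p n ¬p[n+1] rewrite filterᵇ-oneTo-suc p n | ¬p[n+1] = List.++-identityʳ _

count-split : ∀ (p : ℕ → Bool) xs → length (filterᵇ p xs) + length (filterᵇ (not ∘ p) xs) ≡ length xs
count-split p []       = refl
count-split p (x ∷ xs) with p x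
... | true  = cong suc (count-split p xs)
... | false = trans (ℕ.+-suc _ _) (cong suc (count-split p xs))

prodℤ-∷ʳ : ∀ xs x → prodℤ (xs ++ [ x ]) ≡ prodℤ xs ℤ.* x
prodℤ-∷ʳ []       x = trans (ℤ.*-identityʳ x) (sym (ℤ.*-identityˡ x))
prodℤ-∷ʳ (y ∷ xs) x = trans (cong (y ℤ.*_) (prodℤ-∷ʳ xs x)) (sym (ℤ.*-assoc y (prodℤ xs) x))

words⁻ : ∀ k A {σ} → σ ∈ words k A → length σ ≡ k × All (_∈ A) σ
words⁻ zero    A (here refl) = refl , []
words⁻ (suc k) A σ∈ with find (∈-concatMap⁻ (λ a → map (a ∷_) (words k A)) {xs = A} σ∈)
... | a , a∈A , σ∈a∷ with ∈-map⁻ (a ∷_) σ∈a∷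
... | σ′ , σ′∈ , refl = let (l , σ′⊆A) = words⁻ k A σ′∈ in cong suc l , a∈A ∷ σ′⊆A

words⁺ : ∀ k A {σ} → length σ ≡ k → All (_∈ A) σ → σ ∈ words k A
words⁺ zero    A {[]}    refl []           = here refl
words⁺ (suc k) A {a ∷ σ} l    (a∈A ∷ σ⊆A) =
  ∈-concatMap⁺ (λ a → map (a ∷_) (words k A))
    (lose a∈A (∈-map⁺ (a ∷_) (words⁺ k A (ℕ.suc-injective l) σ⊆A)))

words-unique : ∀ k A → Unique A → Unique (words k A)
words-unique zero    A _  = [] ∷ []
words-unique (suc k) A uA =
  unique-concatMap (λ a → map (a ∷_) (words k A)) uA
    (λ _ → Unique.map⁺ ∷-injectiveʳ (words-unique k A uA)) same-head
  where
  same-head : ∀ {a b σ} → a ∈ A → b ∈ A →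
    σ ∈ map (a ∷_) (words k A) → σ ∈ map (b ∷_) (words k A) → a ≡ b
  same-head _ _ σ∈a σ∈b with ∈-map⁻ _ σ∈a | ∈-map⁻ _ σ∈b
  ... | _ , _ , refl | _ , _ , eq = ∷-injectiveˡ eq

IsPerm : ℕ → List ℕ → Set
IsPerm n σ = length σ ≡ n × All (_∈ oneTo n) σ × Unique σ

∈Sym⇒IsPerm : ∀ n {σ} → σ ∈ Sym n → IsPerm n σ
∈Sym⇒IsPerm n σ∈ with ∈-filter⁻ (UniqueDec.unique? ℕ._≟_) {xs = words n (oneTo n)} σ∈
... | σ∈words , u = let (l , σ⊆) = words⁻ n (oneTo n) σ∈words in l , σ⊆ , u

IsPerm⇒∈Sym : ∀ n {σ} → IsPerm n σ → σ ∈ Sym n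
IsPerm⇒∈Sym n (l , σ⊆ , u) = ∈-filter⁺ (UniqueDec.unique? ℕ._≟_) (words⁺ n (oneTo n) l σ⊆) u

Sym-unique : ∀ n → Unique (Sym n)
Sym-unique n = Unique.filter⁺ (UniqueDec.unique? ℕ._≟_) (words-unique n (oneTo n) (oneTo-unique n))

IsPerm-insert : ∀ n xs ys → IsPerm n (xs ++ ys) → IsPerm (suc n) (xs ++ suc n ∷ ys)
IsPerm-insert n xs ys (l , ⊆oneTo , u) =
  trans (↭-length p) (cong suc l) ,
  All-resp-↭ (↭-sym p) (suc∈oneTo-suc n ∷ All.map ∈oneTo-suc⁺ ⊆oneTo) ,
  unique-resp-↭ (↭-sym p) (All.map N≢ ⊆oneTo ∷ u)
  where
  p = shift (suc n) xs ys
  N≢ : ∀ {z} → z ∈ oneTo n → suc n ≢ z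
  N≢ z∈ N≡z = ℕ.1+n≰n (subst (_≤ n) (sym N≡z) (∈oneTo⇒≤ z∈))

max∈perm : ∀ n {σ} → IsPerm (suc n) σ → suc n ∈ σ
max∈perm n {σ} (l , ⊆oneTo , u) with suc n ∈? σ
... | yes N∈σ = N∈σ
... | no  N∉σ = contradiction (unique-⊆⇒length-≤ u σ⊆oneTo-n) too-long
  where
  σ⊆oneTo-n : σ ⊆ oneTo n
  σ⊆oneTo-n z∈ with ∈oneTo-suc⁻ (All.lookup ⊆oneTo z∈)
  ... | inj₁ z∈oneTo = z∈oneTo
  ... | inj₂ refl    = contradiction z∈ N∉σ
  too-long : ¬ length σ ≤ length (oneTo n)
  too-long σ≤ = ℕ.1+n≰n (subst₂ _≤_ l (length-oneTo n) σ≤)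

IsPerm-remove-max : ∀ n {σ} → IsPerm (suc n) σ → ∃₂ λ xs ys → σ ≡ xs ++ suc n ∷ ys × IsPerm n (xs ++ ys)
IsPerm-remove-max n perm@(l , ⊆oneTo , u) with ∈-∃++ (max∈perm n perm)
... | xs , ys , refl with All-resp-↭ p ⊆oneTo | unique-resp-↭ p u
  where p = shift (suc n) xs ys
... | _ ∷ rest⊆ | N∉rest ∷ urest =
  xs , ys , refl ,
  ℕ.suc-injective (trans (sym (↭-length (shift (suc n) xs ys))) l) ,
  All.zipWith (λ (z∈ , N≢z) → lower z∈ N≢z) (rest⊆ , N∉rest) ,
  urest
  where
  lower : ∀ {z} → z ∈ oneTo (suc n) → suc n ≢ z → z ∈ oneTo n
  lower z∈ N≢z with ∈oneTo-suc⁻ z∈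
  ... | inj₁ z∈oneTo = z∈oneTo
  ... | inj₂ z≡N     = contradiction (sym z≡N) N≢z

IsPerm⇒↭oneTo : ∀ n {σ} → IsPerm n σ → σ ↭ oneTo n
IsPerm⇒↭oneTo zero    {[]} _    = ↭-refl
IsPerm⇒↭oneTo (suc n)      perm with IsPerm-remove-max n perm
... | xs , ys , refl , perm′ = subst (xs ++ suc n ∷ ys ↭_) (sym (oneTo-suc n))
  (↭-trans (shift (suc n) xs ys)
  (↭-trans (↭-prep (suc n) (IsPerm⇒↭oneTo n perm′))
           (∷↭∷ʳ (suc n) (oneTo n))))

count-perm : ∀ (p : ℕ → Bool) n {σ} → IsPerm n σ → length (filterᵇ p σ) ≡ length (filterᵇ p (oneTo n))
count-perm p n perm = ↭-length (filter-↭ _ (IsPerm⇒↭oneTo n perm))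

module _ {A : Set} where

  insertions : A → List A → List (List A)
  insertions x []      = [ x ∷ [] ]
  insertions x (a ∷ t) = (x ∷ a ∷ t) ∷ map (a ∷_) (insertions x t)

  ∈insertions⁻ : ∀ x τ {σ} → σ ∈ insertions x τ → ∃₂ λ xs ys → τ ≡ xs ++ ys × σ ≡ xs ++ x ∷ ys
  ∈insertions⁻ x []      (here refl) = [] , [] , refl , refl
  ∈insertions⁻ x (a ∷ t) (here refl) = [] , a ∷ t , refl , refl
  ∈insertions⁻ x (a ∷ t) (there σ∈) with ∈-map⁻ (a ∷_) σ∈
  ... | σ′ , σ′∈ , refl with ∈insertions⁻ x t σ′∈
  ... | xs , ys , refl , refl = a ∷ xs , ys , refl , refl

  ∈insertions⁺ : ∀ x xs ys → xs ++ x ∷ ys ∈ insertions x (xs ++ ys)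
  ∈insertions⁺ x []       []       = here refl
  ∈insertions⁺ x []       (y ∷ ys) = here refl
  ∈insertions⁺ x (a ∷ xs) ys       = there (∈-map⁺ (a ∷_) (∈insertions⁺ x xs ys))

  insertions-unique : ∀ x τ → x ∉ τ → Unique (insertions x τ)
  insertions-unique x []      _   = [] ∷ []
  insertions-unique x (a ∷ t) x∉ =
    All.tabulate first≢rest ∷ Unique.map⁺ ∷-injectiveʳ (insertions-unique x t (x∉ ∘ there))
    where
    first≢rest : ∀ {σ} → σ ∈ map (a ∷_) (insertions x t) → x ∷ a ∷ t ≢ σ
    first≢rest σ∈ eq with ∈-map⁻ (a ∷_) σ∈
    ... | _ , _ , refl = x∉ (here (∷-injectiveˡ eq))

  insertion-injective : ∀ {x} xs₁ xs₂ {ys₁ ys₂ : List A} → x ∉ xs₁ → x ∉ xs₂ →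
    xs₁ ++ x ∷ ys₁ ≡ xs₂ ++ x ∷ ys₂ → xs₁ ++ ys₁ ≡ xs₂ ++ ys₂
  insertion-injective []         []         _  _  eq = ∷-injectiveʳ eq
  insertion-injective []         (b ∷ xs₂)  _  x∉ eq = contradiction (here (∷-injectiveˡ eq)) x∉
  insertion-injective (a ∷ xs₁)  []         x∉ _  eq = contradiction (here (sym (∷-injectiveˡ eq))) x∉
  insertion-injective (a ∷ xs₁)  (b ∷ xs₂)  x∉₁ x∉₂ eq =
    cong₂ _∷_ (∷-injectiveˡ eq)
              (insertion-injective xs₁ xs₂ (x∉₁ ∘ there) (x∉₂ ∘ there) (∷-injectiveʳ eq))

  insertions-disjoint : ∀ x {τ₁ τ₂ σ} → x ∉ τ₁ → x ∉ τ₂ →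
    σ ∈ insertions x τ₁ → σ ∈ insertions x τ₂ → τ₁ ≡ τ₂
  insertions-disjoint x {τ₁} {τ₂} x∉₁ x∉₂ σ∈₁ σ∈₂ with ∈insertions⁻ x τ₁ σ∈₁ | ∈insertions⁻ x τ₂ σ∈₂
  ... | xs₁ , ys₁ , refl , refl | xs₂ , ys₂ , refl , eq =
    insertion-injective xs₁ xs₂ (x∉₁ ∘ ∈-++⁺ˡ) (x∉₂ ∘ ∈-++⁺ˡ) eq

max∉perm : ∀ n {τ} → IsPerm n τ → suc n ∉ τ
max∉perm n (_ , ⊆oneTo , _) N∈ = ℕ.1+n≰n (∈oneTo⇒≤ (All.lookup ⊆oneTo N∈))

Sym-suc-↭ : ∀ n → Sym (suc n) ↭ concatMap (insertions (suc n)) (Sym n)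
Sym-suc-↭ n = unique-⊆⊇⇒↭ (Sym-unique (suc n)) unique-insertions remove-max insert-max
  where
  N = suc n
  unique-insertions : Unique (concatMap (insertions N) (Sym n))
  unique-insertions = unique-concatMap (insertions N) (Sym-unique n)
    (λ τ∈ → insertions-unique N _ (max∉perm n (∈Sym⇒IsPerm n τ∈)))
    (λ τ₁∈ τ₂∈ → insertions-disjoint N (max∉perm n (∈Sym⇒IsPerm n τ₁∈))
                                         (max∉perm n (∈Sym⇒IsPerm n τ₂∈)))
  remove-max : Sym N ⊆ concatMap (insertions N) (Sym n)
  remove-max σ∈ with IsPerm-remove-max n (∈Sym⇒IsPerm N σ∈)
  ... | xs , ys , refl , perm = ∈-concatMap⁺ (insertions N) (lose (IsPerm⇒∈Sym n perm) (∈insertions⁺ N xs ys))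
  insert-max : concatMap (insertions N) (Sym n) ⊆ Sym N
  insert-max σ∈ with find (∈-concatMap⁻ (insertions N) {xs = Sym n} σ∈)
  ... | τ , τ∈ , σ∈ins with ∈insertions⁻ N τ σ∈ins
  ... | xs , ys , refl , refl = IsPerm⇒∈Sym N (IsPerm-insert n xs ys (∈Sym⇒IsPerm n τ∈))

Σ∈-Sym-suc : ∀ n (g : List ℕ → ℤ) →
  Σ∈ (Sym (suc n)) g ≡ Σ∈ (Sym n) (λ τ → Σ∈ (insertions (suc n) τ) g)
Σ∈-Sym-suc n g = trans (Σ∈-↭ g (Sym-suc-↭ n)) (Σ∈-concatMap (insertions (suc n)) (Sym n) g)

𝟙 : Bool → ℕ
𝟙 b = if b then 1 else 0

𝟙≤1 : ∀ b → 𝟙 b ≤ 1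
𝟙≤1 false = z≤n
𝟙≤1 true  = ℕ.≤-refl

count-∷ : ∀ (p : ℕ → Bool) x xs → length (filterᵇ p (x ∷ xs)) ≡ 𝟙 (p x) + length (filterᵇ p xs)
count-∷ p x xs with p x
... | true  = refl
... | false = refl

<ᵇ≡true : ∀ {m n} → m < n → (m <ᵇ n) ≡ true
<ᵇ≡true m<n = Equivalence.to T-≡ (ℕ.<⇒<ᵇ m<n)

module Descents (X Y : Subset) where

  descent : ℕ → ℕ → ℕ
  descent a b = 𝟙 ((b <ᵇ a) ∧ X a ∧ Y b)

  descent-< : ∀ {a b} → a < b → descent a b ≡ 0
  descent-< {a} {b} a<b with b <ᵇ a in b<ᵇa
  ... | false = refl
  ... | true  = contradiction (ℕ.<ᵇ⇒< b a (subst T (sym b<ᵇa) _)) (ℕ.<-asym a<b)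

  descent-from-∈ : ∀ {N c} → X N ≡ true → c < N → descent N c ≡ 𝟙 (Y c)
  descent-from-∈ hX c<N rewrite <ᵇ≡true c<N | hX = refl

  descent-from-∉ : ∀ {N} c → X N ≡ false → descent N c ≡ 0
  descent-from-∉ {N} c hX with c <ᵇ N
  ... | false = refl
  ... | true  rewrite hX = refl

  descent≤Y : ∀ a c → descent a c ≤ 𝟙 (Y c)
  descent≤Y a c with c <ᵇ a | X a | Y c
  ... | false | _     | _     = z≤n
  ... | true  | false | _     = z≤n
  ... | true  | true  | false = z≤n
  ... | true  | true  | true  = ℕ.≤-refl

  descent≤X : ∀ a c → descent a c ≤ 𝟙 (X a)
  descent≤X a c with c <ᵇ a | X a | Y c
  ... | false | _     | _     = z≤n
  ... | true  | false | _     = z≤n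
  ... | true  | true  | false = z≤n
  ... | true  | true  | true  = ℕ.≤-refl

  des-0∷ : ∀ σ → des X Y (0 ∷ σ) ≡ des X Y σ
  des-0∷ []      = refl
  des-0∷ (_ ∷ _) = refl

  des≤count : ∀ σ → des X Y σ ≤ length (filterᵇ X σ)
  des≤count []           = z≤n
  des≤count (a ∷ [])     = z≤n
  des≤count (a ∷ b ∷ σ)  = ℕ.≤-trans (ℕ.+-mono-≤ (descent≤X a b) (des≤count (b ∷ σ)))
                                      (ℕ.≤-reflexive (sym (count-∷ X a (b ∷ σ))))

  first-slot-∈ : ∀ (F : ℕ → ℤ) i y d → i ≤ y → y ≤ 1 →
    F (y + d) ≡ F (i + d) ℤ.+ (+ y ℤ.- + i) ℤ.* (F (suc (i + d)) ℤ.- F (i + d))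
  first-slot-∈ F zero       zero       d _ _ = unchanged (F d) (F (suc d))
    where
    unchanged : ∀ a b → a ≡ a ℤ.+ (+ 0 ℤ.- + 0) ℤ.* (b ℤ.- a)
    unchanged = solve-∀
  first-slot-∈ F zero       (suc zero) d _ _ = raised (F d) (F (suc d))
    where
    raised : ∀ a b → b ≡ a ℤ.+ (+ 1 ℤ.- + 0) ℤ.* (b ℤ.- a)
    raised = solve-∀
  first-slot-∈ F (suc zero) (suc zero) d _ _ = unchanged (F (suc d)) (F (suc (suc d)))
    where
    unchanged : ∀ a b → a ≡ a ℤ.+ (+ 1 ℤ.- + 1) ℤ.* (b ℤ.- a)
    unchanged = solve-∀
  first-slot-∈ F (suc (suc _)) (suc zero) d (s≤s ()) _
  first-slot-∈ F i (suc (suc _)) d _ (s≤s ())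

  -- Inserting N, larger than all letters, between a and c removes the descent a c, creates the descent N c
  -- exactly when X N and Y c, and never creates a descent into N.
  Σ-insertions-∈-after : ∀ {N} → X N ≡ true → ∀ a t → All (_< N) (a ∷ t) → (F : ℕ → ℤ) →
    Σ∈ (insertions N t) (λ σ → F (des X Y (a ∷ σ)))
      ≡ + suc (length t) ℤ.* F (des X Y (a ∷ t))
        ℤ.+ (+ length (filterᵇ Y t) ℤ.- + des X Y (a ∷ t)) ℤ.* (F (suc (des X Y (a ∷ t))) ℤ.- F (des X Y (a ∷ t)))
  Σ-insertions-∈-after hX a [] (a<N ∷ []) F =
    trans (cong (λ k → F (k + 0) ℤ.+ + 0) (descent-< a<N)) (single (F 0) (F 1))
    where
    single : ∀ x y → x ℤ.+ + 0 ≡ + 1 ℤ.* x ℤ.+ (+ 0 ℤ.- + 0) ℤ.* (y ℤ.- x)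
    single = solve-∀
  Σ-insertions-∈-after {N} hX a (c ∷ t) (a<N ∷ c<N ∷ t<N) F = begin
    F (descent a N + (descent N c + d)) ℤ.+ Σ∈ (map (c ∷_) (insertions N t)) (λ σ → F (des X Y (a ∷ σ)))
      ≡⟨ cong₂ ℤ._+_ (cong F first-position) (Σ∈-map (c ∷_) (insertions N t) _) ⟩
    F (y + d) ℤ.+ Σ∈ (insertions N t) (λ σ → F (i + des X Y (c ∷ σ)))
      ≡⟨ cong₂ ℤ._+_ (first-slot-∈ F i y d (descent≤Y a c) (𝟙≤1 (Y c))) other-slots ⟩
    (F (i + d) ℤ.+ (+ y ℤ.- + i) ℤ.* S) ℤ.+ (+ suc (length t) ℤ.* F (i + d) ℤ.+ (+ q ℤ.- + d) ℤ.* S)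
      ≡⟨ regroup (F (i + d)) S (+ y) (+ i) (+ d) (+ q) (+ length t) ⟩
    + suc (suc (length t)) ℤ.* F (i + d) ℤ.+ (+ (y + q) ℤ.- + (i + d)) ℤ.* S
      ≡⟨ cong (λ k → + suc (suc (length t)) ℤ.* F (i + d) ℤ.+ (+ k ℤ.- + (i + d)) ℤ.* S) (count-∷ Y c t) ⟨
    + suc (suc (length t)) ℤ.* F (i + d) ℤ.+ (+ length (filterᵇ Y (c ∷ t)) ℤ.- + (i + d)) ℤ.* S ∎
    where
    i = descent a c
    d = des X Y (c ∷ t)
    y = 𝟙 (Y c)
    q = length (filterᵇ Y t)
    S = F (suc (i + d)) ℤ.- F (i + d)
    first-position : descent a N + (descent N c + d) ≡ y + d
    first-position = cong₂ (λ k l → k + (l + d)) (descent-< a<N) (descent-from-∈ hX c<N)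
    other-slots : Σ∈ (insertions N t) (λ σ → F (i + des X Y (c ∷ σ)))
                  ≡ + suc (length t) ℤ.* F (i + d) ℤ.+ (+ q ℤ.- + d) ℤ.* S
    other-slots = trans (Σ-insertions-∈-after hX c t (c<N ∷ t<N) (λ v → F (i + v)))
      (cong (λ k → + suc (length t) ℤ.* F (i + d) ℤ.+ (+ q ℤ.- + d) ℤ.* (F k ℤ.- F (i + d))) (ℕ.+-suc i d))
    regroup : ∀ A S y i d q L →
      (A ℤ.+ (y ℤ.- i) ℤ.* S) ℤ.+ ((+ 1 ℤ.+ L) ℤ.* A ℤ.+ (q ℤ.- d) ℤ.* S)
        ≡ (+ 1 ℤ.+ (+ 1 ℤ.+ L)) ℤ.* A ℤ.+ ((y ℤ.+ q) ℤ.- (i ℤ.+ d)) ℤ.* S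
    regroup = solve-∀

  first-slot-∉ : ∀ (F : ℕ → ℤ) i d → i ≤ 1 → F d ≡ F (i + d) ℤ.- + i ℤ.* ∇ F (i + d)
  first-slot-∉ F zero       d _ = unchanged (F d) (∇ F d)
    where
    unchanged : ∀ a b → a ≡ a ℤ.- + 0 ℤ.* b
    unchanged = solve-∀
  first-slot-∉ F (suc zero) d _ = lowered (F d) (F (suc d))
    where
    lowered : ∀ a b → a ≡ b ℤ.- + 1 ℤ.* (b ℤ.- a)
    lowered = solve-∀
  first-slot-∉ F (suc (suc _)) d (s≤s ())

  *-∇-shift : ∀ (F : ℕ → ℤ) i d → + d ℤ.* ∇ (λ v → F (i + v)) d ≡ + d ℤ.* ∇ F (i + d)
  *-∇-shift F i zero    = trans (ℤ.*-zeroˡ (F (i + 0))) (sym (ℤ.*-zeroˡ (∇ F (i + 0))))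
  *-∇-shift F i (suc d) rewrite ℕ.+-suc i d = refl

  Σ-insertions-∉-after : ∀ {N} → X N ≡ false → ∀ a t → All (_< N) (a ∷ t) → (F : ℕ → ℤ) →
    Σ∈ (insertions N t) (λ σ → F (des X Y (a ∷ σ)))
      ≡ + suc (length t) ℤ.* F (des X Y (a ∷ t)) ℤ.- + des X Y (a ∷ t) ℤ.* ∇ F (des X Y (a ∷ t))
  Σ-insertions-∉-after hX a [] (a<N ∷ []) F =
    trans (cong (λ k → F (k + 0) ℤ.+ + 0) (descent-< a<N)) (single (F 0))
    where
    single : ∀ x → x ℤ.+ + 0 ≡ + 1 ℤ.* x ℤ.- + 0 ℤ.* x
    single = solve-∀
  Σ-insertions-∉-after {N} hX a (c ∷ t) (a<N ∷ c<N ∷ t<N) F = begin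
    F (descent a N + (descent N c + d)) ℤ.+ Σ∈ (map (c ∷_) (insertions N t)) (λ σ → F (des X Y (a ∷ σ)))
      ≡⟨ cong₂ ℤ._+_ (cong F first-position) (Σ∈-map (c ∷_) (insertions N t) _) ⟩
    F d ℤ.+ Σ∈ (insertions N t) (λ σ → F (i + des X Y (c ∷ σ)))
      ≡⟨ cong₂ ℤ._+_ (first-slot-∉ F i d (ℕ.≤-trans (descent≤Y a c) (𝟙≤1 (Y c)))) other-slots ⟩
    (F (i + d) ℤ.- + i ℤ.* ∇ F (i + d)) ℤ.+ (+ suc (length t) ℤ.* F (i + d) ℤ.- + d ℤ.* ∇ F (i + d))
      ≡⟨ regroup (F (i + d)) (∇ F (i + d)) (+ i) (+ d) (+ length t) ⟩
    + suc (suc (length t)) ℤ.* F (i + d) ℤ.- + (i + d) ℤ.* ∇ F (i + d) ∎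
    where
    i = descent a c
    d = des X Y (c ∷ t)
    first-position : descent a N + (descent N c + d) ≡ d
    first-position = cong₂ (λ k l → k + (l + d)) (descent-< a<N) (descent-from-∉ c hX)
    other-slots : Σ∈ (insertions N t) (λ σ → F (i + des X Y (c ∷ σ)))
                  ≡ + suc (length t) ℤ.* F (i + d) ℤ.- + d ℤ.* ∇ F (i + d)
    other-slots = trans (Σ-insertions-∉-after hX c t (c<N ∷ t<N) (λ v → F (i + v)))
                        (cong (ℤ._-_ (+ suc (length t) ℤ.* F (i + d))) (*-∇-shift F i d))
    regroup : ∀ A B i d L →
      (A ℤ.- i ℤ.* B) ℤ.+ ((+ 1 ℤ.+ L) ℤ.* A ℤ.- d ℤ.* B) ≡ (+ 1 ℤ.+ (+ 1 ℤ.+ L)) ℤ.* A ℤ.- (i ℤ.+ d) ℤ.* B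
    regroup = solve-∀

  -- Insertion at the front is covered by the prefixed form, as a leading 0 never starts a descent.
  Σ-insertions-∈ : ∀ {n} → X (suc n) ≡ true → ∀ τ → All (_< suc n) τ → (F : ℕ → ℤ) →
    Σ∈ (insertions (suc n) τ) (F ∘ des X Y)
      ≡ + suc (length τ) ℤ.* F (des X Y τ)
        ℤ.+ (+ length (filterᵇ Y τ) ℤ.- + des X Y τ) ℤ.* (F (suc (des X Y τ)) ℤ.- F (des X Y τ))
  Σ-insertions-∈ hX τ τ<N F =
    trans (Σ∈-cong (insertions _ τ) (λ σ _ → cong F (sym (des-0∷ σ))))
    (trans (Σ-insertions-∈-after hX 0 τ (s≤s z≤n ∷ τ<N) F)
           (cong (λ d → + suc (length τ) ℤ.* F d ℤ.+ (+ length (filterᵇ Y τ) ℤ.- + d) ℤ.* (F (suc d) ℤ.- F d))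
                 (des-0∷ τ)))

  Σ-insertions-∉ : ∀ {n} → X (suc n) ≡ false → ∀ τ → All (_< suc n) τ → (F : ℕ → ℤ) →
    Σ∈ (insertions (suc n) τ) (F ∘ des X Y)
      ≡ + suc (length τ) ℤ.* F (des X Y τ) ℤ.- + des X Y τ ℤ.* ∇ F (des X Y τ)
  Σ-insertions-∉ hX τ τ<N F =
    trans (Σ∈-cong (insertions _ τ) (λ σ _ → cong F (sym (des-0∷ σ))))
    (trans (Σ-insertions-∉-after hX 0 τ (s≤s z≤n ∷ τ<N) F)
           (cong (λ d → + suc (length τ) ℤ.* F d ℤ.- + d ℤ.* ∇ F d) (des-0∷ τ)))

module DescentFormula (X Y : Subset) where

  open Descents X Y

  #X #Xᶜ : ℕ → ℕ
  #X  n = length (restrict X n)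
  #Xᶜ n = length (restrictᶜ X n)

  factor : ℕ → ℕ → ℕ → ℤ
  factor n r x = + r ℤ.+ + β X n x ℤ.- + β Y n x

  productSide : ℕ → ℕ → ℤ
  productSide n r = + (#Xᶜ n !) ℤ.* + binom (#Xᶜ n + r) r ℤ.* prodℤ (map (factor n r) (restrict X n))

  #Xᶜ-suc-∈ : ∀ {n} → X (suc n) ≡ true → #Xᶜ (suc n) ≡ #Xᶜ n
  #Xᶜ-suc-∈ {n} hX = cong length (filterᵇ-oneTo-suc-reject (not ∘ X) n (cong not hX))

  #Xᶜ-suc-∉ : ∀ {n} → X (suc n) ≡ false → #Xᶜ (suc n) ≡ suc (#Xᶜ n)
  #Xᶜ-suc-∉ {n} hX = trans (cong length (filterᵇ-oneTo-suc-accept (not ∘ X) n (cong not hX)))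
                          (trans (List.length-++ (restrictᶜ X n)) (ℕ.+-comm (#Xᶜ n) 1))

  productSide-∈ : ∀ {n} r → X (suc n) ≡ true → productSide (suc n) r ≡ factor n r (suc n) ℤ.* productSide n r
  productSide-∈ {n} r hX = begin
    + (#Xᶜ (suc n) !) ℤ.* + binom (#Xᶜ (suc n) + r) r ℤ.* prodℤ (map (factor n r) (restrict X (suc n)))
      ≡⟨ cong₂ (λ c xs → + (c !) ℤ.* + binom (c + r) r ℤ.* prodℤ (map (factor n r) xs))
               (#Xᶜ-suc-∈ hX) (filterᵇ-oneTo-suc-accept X n hX) ⟩
    a ℤ.* prodℤ (map (factor n r) (restrict X n ++ [ suc n ]))
      ≡⟨ cong (λ xs → a ℤ.* prodℤ xs) (List.map-++ (factor n r) (restrict X n) [ suc n ]) ⟩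
    a ℤ.* prodℤ (map (factor n r) (restrict X n) ++ [ factor n r (suc n) ])
      ≡⟨ cong (a ℤ.*_) (prodℤ-∷ʳ (map (factor n r) (restrict X n)) (factor n r (suc n))) ⟩
    a ℤ.* (prodℤ (map (factor n r) (restrict X n)) ℤ.* factor n r (suc n))
      ≡⟨ rotate a (prodℤ (map (factor n r) (restrict X n))) (factor n r (suc n)) ⟩
    factor n r (suc n) ℤ.* productSide n r ∎
    where
    a = + (#Xᶜ n !) ℤ.* + binom (#Xᶜ n + r) r
    rotate : ∀ a p f → a ℤ.* (p ℤ.* f) ≡ f ℤ.* (a ℤ.* p)
    rotate = solve-∀

  productSide-∉ : ∀ {n} r → X (suc n) ≡ false → productSide (suc n) r ≡ + suc (#Xᶜ n + r) ℤ.* productSide n r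
  productSide-∉ {n} r hX = begin
    + (#Xᶜ (suc n) !) ℤ.* + binom (#Xᶜ (suc n) + r) r ℤ.* prodℤ (map (factor n r) (restrict X (suc n)))
      ≡⟨ cong₂ (λ c xs → + (c !) ℤ.* + binom (c + r) r ℤ.* prodℤ (map (factor n r) xs))
               (#Xᶜ-suc-∉ hX) (filterᵇ-oneTo-suc-reject X n hX) ⟩
    + (suc c !) ℤ.* + binom (suc c + r) r ℤ.* p
      ≡⟨ cong (ℤ._* p) (sym (ℤ.pos-* (suc c !) _)) ⟩
    + (suc c ! * binom (suc c + r) r) ℤ.* p
      ≡⟨ cong (λ k → + k ℤ.* p) (factorial-binom-suc c r) ⟩
    + (suc (c + r) * (c ! * binom (c + r) r)) ℤ.* p
      ≡⟨ cong (ℤ._* p) (trans (ℤ.pos-* (suc (c + r)) _) (cong (+ suc (c + r) ℤ.*_) (ℤ.pos-* (c !) _))) ⟩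
    + suc (c + r) ℤ.* (+ (c !) ℤ.* + binom (c + r) r) ℤ.* p
      ≡⟨ ℤ.*-assoc (+ suc (c + r)) (+ (c !) ℤ.* + binom (c + r) r) p ⟩
    + suc (c + r) ℤ.* productSide n r ∎
    where
    c = #Xᶜ n
    p = prodℤ (map (factor n r) (restrict X n))

  IsPerm⇒<suc : ∀ {n τ} → IsPerm n τ → All (_< suc n) τ
  IsPerm⇒<suc (_ , ⊆oneTo , _) = All.map (s≤s ∘ ∈oneTo⇒≤) ⊆oneTo

  #Y+#Yᶜ : ∀ {n τ} → IsPerm n τ → length (filterᵇ Y τ) + β Y n (suc n) ≡ n
  #Y+#Yᶜ {n} perm = trans (cong (_+ β Y n (suc n)) (count-perm Y n perm))
                         (trans (count-split Y (oneTo n)) (length-oneTo n))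

  insert-max-∈ : ∀ {n τ} r → IsPerm n τ → X (suc n) ≡ true →
    Σ∈ (insertions (suc n) τ) (λ σ → + binom (#Xᶜ (suc n) + r + des X Y σ) (suc n))
      ≡ factor n r (suc n) ℤ.* + binom (#Xᶜ n + r + des X Y τ) n
  insert-max-∈ {n} {τ} r perm hX rewrite #Xᶜ-suc-∈ {n} hX = begin
    Σ∈ (insertions (suc n) τ) (F ∘ des X Y)
      ≡⟨ Σ-insertions-∈ hX τ (IsPerm⇒<suc perm) F ⟩
    + suc (length τ) ℤ.* F d ℤ.+ (+ #Y ℤ.- + d) ℤ.* (F (suc d) ℤ.- F d)
      ≡⟨ cong₂ (λ l b → + suc l ℤ.* F d ℤ.+ (+ #Y ℤ.- + d) ℤ.* b) (proj₁ perm) Δ ⟩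
    + suc n ℤ.* + binom K (suc n) ℤ.+ (+ #Y ℤ.- + d) ℤ.* + binom K n
      ≡⟨ cong (ℤ._+ (+ #Y ℤ.- + d) ℤ.* + binom K n) (binom-ratioℤ K n) ⟩
    (+ K ℤ.- + n) ℤ.* + binom K n ℤ.+ (+ #Y ℤ.- + d) ℤ.* + binom K n
      ≡⟨ cong (λ m → (+ K ℤ.- + m) ℤ.* + binom K n ℤ.+ (+ #Y ℤ.- + d) ℤ.* + binom K n) (#Y+#Yᶜ perm) ⟨
    (+ K ℤ.- + (#Y + #Yᶜ)) ℤ.* + binom K n ℤ.+ (+ #Y ℤ.- + d) ℤ.* + binom K n
      ≡⟨ collect (+ c) (+ r) (+ d) (+ #Y) (+ #Yᶜ) (+ binom K n) ⟩
    factor n r (suc n) ℤ.* + binom K n ∎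
    where
    c = #Xᶜ n
    d = des X Y τ
    K = c + r + d
    #Y = length (filterᵇ Y τ)
    #Yᶜ = β Y n (suc n)
    F : ℕ → ℤ
    F v = + binom (c + r + v) (suc n)
    Δ : F (suc d) ℤ.- F d ≡ + binom K n
    Δ = trans (cong (λ k → + binom k (suc n) ℤ.- F d) (ℕ.+-suc (c + r) d)) (pascal-Δ K n)
    collect : ∀ c r d y y′ b →
      ((c ℤ.+ r ℤ.+ d) ℤ.- (y ℤ.+ y′)) ℤ.* b ℤ.+ (y ℤ.- d) ℤ.* b ≡ (r ℤ.+ c ℤ.- y′) ℤ.* b
    collect = solve-∀

  insert-max-∉ : ∀ {n τ} r → IsPerm n τ → X (suc n) ≡ false →
    Σ∈ (insertions (suc n) τ) (λ σ → + binom (#Xᶜ (suc n) + r + des X Y σ) (suc n))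
      ≡ + suc (#Xᶜ n + r) ℤ.* + binom (#Xᶜ n + r + des X Y τ) n
  insert-max-∉ {n} {τ} r perm hX rewrite #Xᶜ-suc-∉ {n} hX = begin
    Σ∈ (insertions (suc n) τ) (F ∘ des X Y)
      ≡⟨ Σ-insertions-∉ hX τ (IsPerm⇒<suc perm) F ⟩
    + suc (length τ) ℤ.* F d ℤ.- + d ℤ.* ∇ F d
      ≡⟨ cong₂ (λ l b → + suc l ℤ.* F d ℤ.- b) (proj₁ perm) (*-∇F d) ⟩
    + suc n ℤ.* + binom (suc K) (suc n) ℤ.- + d ℤ.* + binom K n
      ≡⟨ cong (ℤ._- + d ℤ.* + binom K n) (binom-absorbℤ K n) ⟩
    + suc K ℤ.* + binom K n ℤ.- + d ℤ.* + binom K n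
      ≡⟨ collect (+ (c + r)) (+ d) (+ binom K n) ⟩
    + suc (c + r) ℤ.* + binom K n ∎
    where
    c = #Xᶜ n
    d = des X Y τ
    K = c + r + d
    F : ℕ → ℤ
    F v = + binom (suc (c + r + v)) (suc n)
    *-∇F : ∀ d → + d ℤ.* ∇ F d ≡ + d ℤ.* + binom (c + r + d) n
    *-∇F zero    = trans (ℤ.*-zeroˡ (F 0)) (sym (ℤ.*-zeroˡ (+ binom (c + r + 0) n)))
    *-∇F (suc d) rewrite ℕ.+-suc (c + r) d = cong (+ suc d ℤ.*_) (pascal-Δ (suc (c + r + d)) n)
    collect : ∀ m d b → (+ 1 ℤ.+ (m ℤ.+ d)) ℤ.* b ℤ.- d ℤ.* b ≡ (+ 1 ℤ.+ m) ℤ.* b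
    collect = solve-∀

  Σ-binom-des-suc : ∀ n r κ →
    (∀ {τ} → IsPerm n τ → Σ∈ (insertions (suc n) τ) (λ σ → + binom (#Xᶜ (suc n) + r + des X Y σ) (suc n))
                           ≡ κ ℤ.* + binom (#Xᶜ n + r + des X Y τ) n) →
    Σ∈ (Sym (suc n)) (λ σ → + binom (#Xᶜ (suc n) + r + des X Y σ) (suc n))
      ≡ κ ℤ.* Σ∈ (Sym n) (λ τ → + binom (#Xᶜ n + r + des X Y τ) n)
  Σ-binom-des-suc n r κ insert-max =
    trans (Σ∈-Sym-suc n _)
    (trans (Σ∈-cong (Sym n) (λ τ τ∈ → insert-max (∈Sym⇒IsPerm n τ∈)))
           (sym (*-distribˡ-Σ∈ (Sym n) κ _)))

  Σ-binom-des≡productSide : ∀ n r → Σ∈ (Sym n) (λ σ → + binom (#Xᶜ n + r + des X Y σ) n) ≡ productSide n r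
  Σ-binom-des≡productSide zero    r =
    trans (cong (λ b → + b ℤ.+ + 0) (binom-n0 (r + 0))) (cong (λ b → + 1 ℤ.* + b ℤ.* + 1) (sym (binom-nn r)))
  Σ-binom-des≡productSide (suc n) r with X (suc n) in hX
  ... | true  = trans (Σ-binom-des-suc n r (factor n r (suc n)) (λ perm → insert-max-∈ r perm hX))
                      (trans (cong (factor n r (suc n) ℤ.*_) (Σ-binom-des≡productSide n r)) (sym (productSide-∈ r hX)))
  ... | false = trans (Σ-binom-des-suc n r (+ suc (#Xᶜ n + r)) (λ perm → insert-max-∉ r perm hX))
                      (trans (cong (+ suc (#Xᶜ n + r) ℤ.*_) (Σ-binom-des≡productSide n r)) (sym (productSide-∉ r hX)))

  #X+#Xᶜ : ∀ n → #X n + #Xᶜ n ≡ n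
  #X+#Xᶜ n = trans (count-split X (oneTo n)) (length-oneTo n)

  des≤#X : ∀ {n σ} → σ ∈ Sym n → des X Y σ ≤ #X n
  des≤#X {n} {σ} σ∈ = ℕ.≤-trans (des≤count σ) (ℕ.≤-reflexive (count-perm X n (∈Sym⇒IsPerm n σ∈)))

  summand : ℕ → ℕ → ℕ → ℤ
  summand n s r = (- + 1) ^ (#X n ∸ s ∸ r) ℤ.* + ((#Xᶜ n + r) C r) ℤ.* + (suc n C (#X n ∸ s ∸ r))
                  ℤ.* prodℤ (map (factor n r) (restrict X n))

  c!*summand : ∀ n s r → + (#Xᶜ n !) ℤ.* summand n s r
                         ≡ sgn (#X n ∸ s ∸ r) ℤ.* + binom (suc n) (#X n ∸ s ∸ r) ℤ.* productSide n r
  c!*summand n s r rewrite C≡binom (#Xᶜ n + r) r | C≡binom (suc n) (#X n ∸ s ∸ r) =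
    reassociate (+ (#Xᶜ n !)) (sgn (#X n ∸ s ∸ r)) (+ binom (#Xᶜ n + r) r) (+ binom (suc n) (#X n ∸ s ∸ r)) _
    where
    reassociate : ∀ f e b₁ b₂ p →
      f ℤ.* (e ℤ.* b₁ ℤ.* b₂ ℤ.* p) ≡ e ℤ.* b₂ ℤ.* (f ℤ.* b₁ ℤ.* p)
    reassociate = solve-∀

  δ-des≡alternating-sum : ∀ {n s σ} → s ≤ #X n → σ ∈ Sym n → let M = #X n ∸ s in
    δ (des X Y σ) s
      ≡ Σ< (suc M) (λ r → sgn (M ∸ r) ℤ.* + binom (suc n) (M ∸ r) ℤ.* + binom (#Xᶜ n + r + des X Y σ) n)
  δ-des≡alternating-sum {n} {s} {σ} s≤m σ∈ = sym (begin
    Σ< (suc M) (λ r → A r ℤ.* + binom (c + r + d) n)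
      ≡⟨ Σ<-cong (suc M) (λ r _ → cong (λ k → A r ℤ.* + binom k n) (+-swapʳ c r d)) ⟩
    Σ< (suc M) (λ r → A r ℤ.* + binom (c + d + r) n)
      ≡⟨ binom-inversion n (c + d) M c+d≤n ⟩
    δ (c + d + M) n
      ≡⟨ cong₂ δ (+-swapʳ c d M) n≡c+M+s ⟩
    δ (c + M + d) (c + M + s)
      ≡⟨ δ-+ˡ (c + M) d s ⟩
    δ d s ∎)
    where
    c = #Xᶜ n
    d = des X Y σ
    M = #X n ∸ s
    A : ℕ → ℤ
    A r = sgn (M ∸ r) ℤ.* + binom (suc n) (M ∸ r)
    +-swapʳ : ∀ a b c → a + b + c ≡ a + c + b
    +-swapʳ = ℕ-Solver.solve-∀
    c+m≡n : c + #X n ≡ n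
    c+m≡n = trans (ℕ.+-comm c (#X n)) (#X+#Xᶜ n)
    c+d≤n : c + d ≤ n
    c+d≤n = ℕ.≤-trans (ℕ.+-monoʳ-≤ c (des≤#X {n} σ∈)) (ℕ.≤-reflexive c+m≡n)
    n≡c+M+s : n ≡ c + M + s
    n≡c+M+s = trans (sym c+m≡n) (trans (cong (_+_ c) (sym (ℕ.m∸n+n≡m s≤m))) (sym (ℕ.+-assoc c M s)))

  P≡formula-≤ : ∀ {n s} → s ≤ #X n → + P X Y n s ≡ + (#Xᶜ n !) ℤ.* sumTo (+ #X n ℤ.- + s) (summand n s)
  P≡formula-≤ {n} {s} s≤m = begin
    + P X Y n s
      ≡⟨ length-filter≡Σ∈δ (des X Y) s (Sym n) ⟩
    Σ∈ (Sym n) (λ σ → δ (des X Y σ) s)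
      ≡⟨ Σ∈-cong (Sym n) (λ σ σ∈ → δ-des≡alternating-sum s≤m σ∈) ⟩
    Σ∈ (Sym n) (λ σ → Σ< (suc M) (λ r → A r ℤ.* + binom (c + r + des X Y σ) n))
      ≡⟨ Σ<-Σ∈-comm (suc M) (Sym n) (λ σ r → A r ℤ.* + binom (c + r + des X Y σ) n) ⟨
    Σ< (suc M) (λ r → Σ∈ (Sym n) (λ σ → A r ℤ.* + binom (c + r + des X Y σ) n))
      ≡⟨ Σ<-cong (suc M) (λ r _ → term r) ⟩
    Σ< (suc M) (λ r → + (c !) ℤ.* summand n s r)
      ≡⟨ *-distribˡ-Σ< (suc M) (+ (c !)) (summand n s) ⟨
    + (c !) ℤ.* Σ< (suc M) (summand n s)
      ≡⟨ cong (+ (c !) ℤ.*_) (sumTo≡Σ< M (summand n s)) ⟨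
    + (c !) ℤ.* sumTo (+ M) (summand n s)
      ≡⟨ cong (λ k → + (c !) ℤ.* sumTo k (summand n s)) (trans (ℤ.m-n≡m⊖n (#X n) s) (ℤ.⊖-≥ s≤m)) ⟨
    + (c !) ℤ.* sumTo (+ #X n ℤ.- + s) (summand n s) ∎
    where
    c = #Xᶜ n
    M = #X n ∸ s
    A : ℕ → ℤ
    A r = sgn (M ∸ r) ℤ.* + binom (suc n) (M ∸ r)
    term : ∀ r → Σ∈ (Sym n) (λ σ → A r ℤ.* + binom (c + r + des X Y σ) n) ≡ + (c !) ℤ.* summand n s r
    term r = begin
      Σ∈ (Sym n) (λ σ → A r ℤ.* + binom (c + r + des X Y σ) n) ≡⟨ *-distribˡ-Σ∈ (Sym n) (A r) _ ⟨
      A r ℤ.* Σ∈ (Sym n) (λ σ → + binom (c + r + des X Y σ) n) ≡⟨ cong (A r ℤ.*_) (Σ-binom-des≡productSide n r) ⟩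
      A r ℤ.* productSide n r                                   ≡⟨ c!*summand n s r ⟨
      + (c !) ℤ.* summand n s r                                 ∎

  P≡formula-> : ∀ {n s} → #X n < s → + P X Y n s ≡ + (#Xᶜ n !) ℤ.* sumTo (+ #X n ℤ.- + s) (summand n s)
  P≡formula-> {n} {s} m<s = begin
    + P X Y n s
      ≡⟨ length-filter≡Σ∈δ (des X Y) s (Sym n) ⟩
    Σ∈ (Sym n) (λ σ → δ (des X Y σ) s)
      ≡⟨ Σ∈-zero (Sym n) (λ σ σ∈ → δ-≢ (ℕ.<⇒≢ (ℕ.≤-<-trans (des≤#X {n} σ∈) m<s))) ⟩
    + 0
      ≡⟨ ℤ.*-zeroʳ (+ (#Xᶜ n !)) ⟨
    + (#Xᶜ n !) ℤ.* sumTo -[1+ s ∸ suc (#X n) ] (summand n s)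
      ≡⟨ cong (λ k → + (#Xᶜ n !) ℤ.* sumTo k (summand n s)) m-s≡negative ⟨
    + (#Xᶜ n !) ℤ.* sumTo (+ #X n ℤ.- + s) (summand n s) ∎
    where
    m-s≡negative : + #X n ℤ.- + s ≡ -[1+ s ∸ suc (#X n) ]
    m-s≡negative = trans (ℤ.m-n≡m⊖n (#X n) s) (trans (ℤ.⊖-< m<s) (cong (-_ ∘ +_) (ℕ.+-∸-assoc 1 m<s)))

theorem2p5 : (X Y : Subset) (n s : ℕ) → 1 ≤ n →
    + P X Y n s ≡
      + ((length (restrictᶜ X n)) !) ℤ.*
        sumTo (+ length (restrict X n) ℤ.- + s)
          (λ r → ((- + 1) ^ (length (restrict X n) ∸ s ∸ r))
                 ℤ.* + ((length (restrictᶜ X n) + r) C r)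
                 ℤ.* + (suc n C (length (restrict X n) ∸ s ∸ r))
                 ℤ.* prodℤ (map (λ x → + r ℤ.+ + β X n x ℤ.- + β Y n x) (restrict X n)))
theorem2p5 X Y n s _ with s ℕ.≤? length (restrict X n)
... | yes s≤m = DescentFormula.P≡formula-≤ X Y s≤m
... | no  s≰m = DescentFormula.P≡formula-> X Y (ℕ.≰⇒> s≰m)
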